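{- Let \(G\) be a trigraph and \(A\subseteq V(G)\) a set of vertices each of which has red degree \(0\) in \(G\). Then \[\operatorname{tww}(G,A)\leq 2^{|A|}\operatorname{tww}(G)+2^{|A|+1}-2.\]
   Context: A trigraph is a graph whose edges are partitioned into black and red edges; the red degree of a vertex is its number of incident red edges. For distinct vertices \(x,y\), the contraction \(G/xy\) replaces \(x,y\) by a new vertex \(z\), keeps edges not incident to \(x,y\), joins \(z\) by a black edge to every common black neighbour of \(x,y\), and by a red edge to every other vertex adjacent to \(x\) or \(y\). A partial contraction sequence \(G=G_0,\dots,G_m\) has width the maximum red degree over all \(G_i\); \(\operatorname{tww}(G)\) is the minimum width of one ending in a single vertex. For \(A\subseteq V(G)\) of red degree 0, a partial contraction sequence respects \(A\) if no vertex of \(A\) is ever contracted, \(G_i[A]=G[A]\), and every vertex of \(A\) has red degree 0 in every \(G_i\) (equivalently, each contracted pair \(x,y\notin A\) has the same neighbourhood in \(A\)). It is complete if it cannot be extended by a further contraction respecting \(A\), i.e. no two vertices of \(V(G_m)\setminus A\) have the same neighbourhood in \(A\). \(\operatorname{tww}(G,A)\) is the minimum \(d\) such that there is a complete contraction sequence respecting \(A\) of width at most \(d\). -}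

module Defs where

open import Data.Nat using (ℕ; zero; suc; _≤_)
open import Data.Fin using (Fin; punchIn; _≟_)
open import Data.Bool using (Bool; true; false)
open import Data.List using (List; length; filter; allFin)
open import Data.Product using (Σ; _×_; _,_)
open import Relation.Nullary using (¬_; Dec; yes; no)
open import Relation.Binary.PropositionalEquality using (_≡_; _≢_)

data Adj : Set where
  none  : Adj
  black : Adj
  red   : Adj

isRed? : (a : Adj) → Dec (a ≡ red)
isRed? none  = no (λ ())
isRed? black = no (λ ())
isRed? red   = yes _≡_.refl

Mat : ℕ → Set
Mat n = Fin n → Fin n → Adj

record IsTrigraph {n : ℕ} (E : Mat n) : Set where
  field
    sym    : ∀ u v → E u v ≡ E v u
    irrefl : ∀ u → E u u ≡ none

VSet : ℕ → Set
VSet n = Fin n → Bool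

card : {n : ℕ} → VSet n → ℕ
card {n} A = length (filter (λ v → A v Data.Bool.≟ true) (allFin n))

redDeg : {n : ℕ} → Mat n → Fin n → ℕ
redDeg {n} E u = length (filter (λ v → isRed? (E u v)) (allFin n))

-- Adjacency of the merged vertex z to a vertex w, from the adjacencies of x and y to w:
-- black iff w is a common black neighbour, none iff w adjacent to neither, red otherwise.
merge : Adj → Adj → Adj
merge black black = black
merge none  none  = none
merge _     _     = red

-- Vertex u of the result corresponds to old vertex (punchIn y u) (y is removed);
-- the new vertex z is the one with punchIn y u ≡ x.
contract : {n : ℕ} → Mat (suc n) → Fin (suc n) → Fin (suc n) → Mat n
contract E x y u v with punchIn y u ≟ x | punchIn y v ≟ x
... | yes _ | yes _ = none
... | yes _ | no  _ = merge (E x (punchIn y v)) (E y (punchIn y v))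
... | no  _ | yes _ = merge (E (punchIn y u) x) (E (punchIn y u) y)
... | no  _ | no  _ = E (punchIn y u) (punchIn y v)

-- Image of a vertex set under the contraction (x,y ∉ A, so A is just relabelled).
contractSet : {n : ℕ} → VSet (suc n) → Fin (suc n) → VSet n
contractSet A y u = A (punchIn y u)

MaxRedDeg≤ : {n : ℕ} → Mat n → ℕ → Set
MaxRedDeg≤ {n} E d = ∀ u → redDeg E u ≤ d

RedFree : {n : ℕ} → Mat n → VSet n → Set
RedFree E A = ∀ a → A a ≡ true → redDeg E a ≡ 0

-- Partial contraction sequences of width ≤ d respecting A, from (E , A) to (E' , A'):
-- every trigraph G_i has max red degree ≤ d, no vertex of A is ever contracted,
-- and every vertex of A has red degree 0 in every G_i.
-- (G_i[A] = G[A] holds automatically since edges among uncontracted vertices are kept.)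
data PSeq (d : ℕ) : {n : ℕ} → Mat n → VSet n → {m : ℕ} → Mat m → VSet m → Set where
  done : {n : ℕ} {E : Mat n} {A : VSet n} →
         MaxRedDeg≤ E d → RedFree E A → PSeq d E A E A
  step : {n : ℕ} {E : Mat (suc n)} {A : VSet (suc n)} {m : ℕ} {E' : Mat m} {A' : VSet m} →
         MaxRedDeg≤ E d → RedFree E A →
         (x y : Fin (suc n)) → x ≢ y → A x ≡ false → A y ≡ false →
         PSeq d (contract E x y) (contractSet A y) E' A' →
         PSeq d E A E' A'

noVertices : {n : ℕ} → VSet n
noVertices _ = false

TwwAtMost : {n : ℕ} → Mat n → ℕ → Set
TwwAtMost E d = Σ (Mat 1) λ E' → Σ (VSet 1) λ A' → PSeq d E noVertices E' A'

Complete : {m : ℕ} → Mat m → VSet m → Set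
Complete E A = ∀ u v → u ≢ v → A u ≡ false → A v ≡ false →
               ¬ (∀ a → A a ≡ true → E u a ≡ E v a)

TwwRelAtMost : {n : ℕ} → Mat n → VSet n → ℕ → Set
TwwRelAtMost E A d = Σ ℕ λ m → Σ (Mat m) λ E' → Σ (VSet m) λ A' →
                     PSeq d E A E' A' × Complete E' A'

-- Run the given contraction sequence H₀ = G, …, H_t of width d and build alongside it a sequence of
-- contractions of G respecting A, keeping its current trigraph F together with a map π from V(F) onto
-- V(H_i) such that an edge of F between different parts equals the edge of H_i between their images
-- unless the latter is red.  Call a part reduced if its vertices outside A have pairwise different
-- neighbourhoods in A; it then has at most 2^|A| of them.  When H_i contracts x and y, their parts
-- merge into one with at most 2·2^|A| vertices outside A, and F contracts pairs of A-twins in it until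
-- it is reduced again, so that after each such contraction that part has fewer than 2·2^|A|.  A red
-- neighbour of a vertex u of F lies in the part of u or in one of the at most d parts red-adjacent to
-- it in H_i, and only one of these d + 1 parts can exceed 2^|A|, so u has red degree at most
-- (d + 1)·2^|A| + (2^|A| − 1) − 1.  Once H is a single vertex, all parts being reduced is completeness.

module Submission where

open import Defs
open import Data.Nat using (ℕ; zero; suc; _+_; _*_; _∸_; _^_; _≤_; _<_; z≤n; s≤s)
open import Data.Nat.Properties
  using ( +-*-semiring; ≤-refl; ≤-trans; ≤-reflexive; +-mono-≤; +-monoˡ-≤; +-monoʳ-≤; *-monoʳ-≤
        ; +-comm; +-identityʳ; *-zeroʳ; *-identityʳ; +-cancelˡ-≤; m^n>0; m<m+n; n≤1+n; ^-distribˡ-+-*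
        ; module ≤-Reasoning )
open import Data.Nat.Tactic.RingSolver using (solve-∀)
open import Algebra.Properties.Semiring.Sum +-*-semiring
  using (sum; sum-cong-≗; sum-replicate-zero; sum-remove; ∑-distrib-+; ∑-comm; *-distribˡ-sum)
open import Data.Bool using (Bool; true; false; _∧_; _∨_; not) renaming (_≟_ to _≟ᵇ_)
open import Data.Bool.Properties using (not-injective; ¬-not; ∨-zeroʳ)
open import Data.Fin using (Fin; zero; suc; punchIn; punchOut; _≟_)
open import Data.Fin.Properties using (¬Fin0; punchInᵢ≢i; punchIn-injective; punchIn-punchOut; all?; any?)
open import Data.List using (length; filter; tabulate)
open import Data.Product using (Σ; _×_; _,_; ∃₂)
open import Data.Sum using (_⊎_; inj₁; inj₂)
open import Function using (_∘_)
open import Relation.Nullary using (Dec; yes; no; does; ¬_; contradiction; ¬?; _×-dec_; _→-dec_)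
open import Relation.Nullary.Decidable using (map′; decidable-stable)
open import Relation.Unary using (Decidable)
open import Relation.Binary.PropositionalEquality

-- Counting over Fin

indicator : Bool → ℕ
indicator true  = 1
indicator false = 0

count : ∀ {n} → (Fin n → Bool) → ℕ
count p = sum (indicator ∘ p)

∧≡true⇒ˡ : ∀ {a b} → a ∧ b ≡ true → a ≡ true
∧≡true⇒ˡ {true} _ = refl

∧≡true⇒ʳ : ∀ a {b} → a ∧ b ≡ true → b ≡ true
∧≡true⇒ʳ true ab≡true = ab≡true

_==_ : ∀ {n} → Fin n → Fin n → Bool
i == j = does (i ≟ j)

==-refl : ∀ {n} (i : Fin n) → (i == i) ≡ true
==-refl i with i ≟ i
... | yes _   = refl
... | no  i≢i = contradiction refl i≢i

==-≢ : ∀ {n} {i j : Fin n} → i ≢ j → (i == j) ≡ false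
==-≢ {i = i} {j} i≢j with i ≟ j
... | yes i≡j = contradiction i≡j i≢j
... | no  _   = refl

==-sound : ∀ {n} {i j : Fin n} → (i == j) ≡ true → i ≡ j
==-sound {i = i} {j} eq with i ≟ j
... | yes i≡j = i≡j

sum-mono-≤ : ∀ {n} {f g : Fin n → ℕ} → (∀ i → f i ≤ g i) → sum f ≤ sum g
sum-mono-≤ {zero}  f≤g = z≤n
sum-mono-≤ {suc n} f≤g = +-mono-≤ (f≤g zero) (sum-mono-≤ (f≤g ∘ suc))

sum-zero : ∀ {n} {f : Fin n → ℕ} → (∀ i → f i ≡ 0) → sum f ≡ 0
sum-zero {n} f≡0 = trans (sum-cong-≗ f≡0) (sum-replicate-zero n)

sum-single : ∀ {n} (f : Fin n → ℕ) (c : Fin n) → (∀ i → i ≢ c → f i ≡ 0) → sum f ≡ f c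
sum-single {suc n} f c f≡0 = begin
  sum f                      ≡⟨ sum-remove f ⟩
  f c + sum (f ∘ punchIn c)  ≡⟨ cong (f c +_) (sum-zero (λ i → f≡0 (punchIn c i) (punchInᵢ≢i c i))) ⟩
  f c + 0                    ≡⟨ +-identityʳ (f c) ⟩
  f c                        ∎
  where open ≡-Reasoning

count-false : ∀ {n} {p : Fin n → Bool} → (∀ i → p i ≡ false) → count p ≡ 0
count-false p≡false = sum-zero (cong indicator ∘ p≡false)

count≡0⇒false : ∀ {n} (p : Fin n → Bool) → count p ≡ 0 → ∀ i → p i ≡ false
count≡0⇒false {suc n} p count≡0 i with p i | sum-remove {i = i} (indicator ∘ p)
... | false | _  = refl
... | true  | eq with trans (sym eq) count≡0
...   | ()

count-mono : ∀ {n} {p q : Fin n → Bool} → (∀ i → p i ≡ true → q i ≡ true) → count p ≤ count q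
count-mono {p = p} {q} p⇒q = sum-mono-≤ pointwise
  where
  pointwise : ∀ i → indicator (p i) ≤ indicator (q i)
  pointwise i with p i | p⇒q i
  ... | false | _   = z≤n
  ... | true  | q≡t rewrite q≡t refl = ≤-refl

count-∨ : ∀ {n} (p q : Fin n → Bool) → count (λ i → p i ∨ q i) ≤ count p + count q
count-∨ p q = ≤-trans (sum-mono-≤ (λ i → indicator-∨ (p i) (q i)))
                      (≤-reflexive (∑-distrib-+ (indicator ∘ p) (indicator ∘ q)))
  where
  indicator-∨ : ∀ a b → indicator (a ∨ b) ≤ indicator a + indicator b
  indicator-∨ true  b = s≤s z≤n
  indicator-∨ false b = ≤-refl

count-split : ∀ {n} (p q : Fin n → Bool) →
  count p ≡ count (λ i → p i ∧ q i) + count (λ i → p i ∧ not (q i))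
count-split p q = trans (sum-cong-≗ (λ i → indicator-split (p i) (q i)))
  (∑-distrib-+ (λ i → indicator (p i ∧ q i)) (λ i → indicator (p i ∧ not (q i))))
  where
  indicator-split : ∀ a b → indicator a ≡ indicator (a ∧ b) + indicator (a ∧ not b)
  indicator-split true  true  = refl
  indicator-split true  false = refl
  indicator-split false b     = refl

count-punchIn : ∀ {n} (p : Fin (suc n) → Bool) (i : Fin (suc n)) →
  count p ≡ indicator (p i) + count (p ∘ punchIn i)
count-punchIn p i = sum-remove (indicator ∘ p)

count-punchIn-false : ∀ {n} (p : Fin (suc n) → Bool) {i} → p i ≡ false → count (p ∘ punchIn i) ≡ count p
count-punchIn-false p {i} pi≡false = sym (trans (count-punchIn p i) (cong (λ b → indicator b + count (p ∘ punchIn i)) pi≡false))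

count-insert : ∀ {n} (p : Fin n → Bool) (i : Fin n) → p i ≡ false →
  count (λ j → (j == i) ∨ p j) ≡ suc (count p)
count-insert {suc n} p i pi≡false = begin
  count (λ j → (j == i) ∨ p j)
    ≡⟨ count-punchIn (λ j → (j == i) ∨ p j) i ⟩
  indicator ((i == i) ∨ p i) + count (λ j → (punchIn i j == i) ∨ p (punchIn i j))
    ≡⟨ cong₂ (λ a b → indicator (a ∨ p i) + b) (==-refl i)
             (sum-cong-≗ (λ j → cong (λ a → indicator (a ∨ p (punchIn i j))) (==-≢ (punchInᵢ≢i i j)))) ⟩
  suc (count (p ∘ punchIn i))
    ≡⟨ cong suc (count-punchIn-false p pi≡false) ⟩
  suc (count p) ∎
  where open ≡-Reasoning

count-== : ∀ {n} (i : Fin n) → count (_== i) ≡ 1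
count-== i = trans (sum-single _ i (λ j j≢i → cong indicator (==-≢ j≢i))) (cong indicator (==-refl i))

count≤1 : ∀ {n} (p : Fin n → Bool) → (∀ i j → p i ≡ true → p j ≡ true → i ≡ j) → count p ≤ 1
count≤1 {zero}  p unique = z≤n
count≤1 {suc n} p unique with any? (λ i → p i ≟ᵇ true)
... | no ∄i = ≤-trans (≤-reflexive (count-false (λ i → ¬-not (λ pi≡t → ∄i (i , pi≡t))))) z≤n
... | yes (i , pi≡true) = ≤-reflexive (begin
  count p                               ≡⟨ count-punchIn p i ⟩
  indicator (p i) + count (p ∘ punchIn i) ≡⟨ cong₂ (λ a b → indicator a + b) pi≡true (count-false others) ⟩
  1                                     ∎)
  where
  open ≡-Reasoning
  others : ∀ j → p (punchIn i j) ≡ false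
  others j = ¬-not (λ pj≡true → punchInᵢ≢i i j (unique _ _ pj≡true pi≡true))

count-fibres : ∀ {m n} (π : Fin m → Fin n) (h : Fin n → Bool) (q : Fin m → Bool) →
  count (λ v → h (π v) ∧ q v) ≡ sum (λ w → indicator (h w) * count (λ v → (π v == w) ∧ q v))
count-fibres {m} {n} π h q = begin
  sum (λ v → indicator (h (π v) ∧ q v))
    ≡⟨ sum-cong-≗ (λ v → trans (sym (on-fibre v)) (sym (sum-single (term v) (π v) (off-fibre v)))) ⟩
  sum (λ v → sum (term v))
    ≡⟨ ∑-comm (λ v w → term v w) ⟩
  sum (λ w → sum (λ v → term v w))
    ≡⟨ sum-cong-≗ (λ w → sym (*-distribˡ-sum (indicator (h w)) (λ v → indicator ((π v == w) ∧ q v)))) ⟩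
  sum (λ w → indicator (h w) * count (λ v → (π v == w) ∧ q v)) ∎
  where
  open ≡-Reasoning
  term : Fin m → Fin n → ℕ
  term v w = indicator (h w) * indicator ((π v == w) ∧ q v)
  off-fibre : ∀ v w → w ≢ π v → term v w ≡ 0
  off-fibre v w w≢πv rewrite ==-≢ (λ πv≡w → w≢πv (sym πv≡w)) = *-zeroʳ (indicator (h w))
  on-fibre : ∀ v → term v (π v) ≡ indicator (h (π v) ∧ q v)
  on-fibre v rewrite ==-refl (π v) with h (π v) | q v
  ... | true  | b = +-identityʳ (indicator b)
  ... | false | b = refl

length-filter-tabulate : ∀ {A : Set} {P : A → Set} (P? : Decidable P) {n} (f : Fin n → A) →
  length (filter P? (tabulate f)) ≡ count (λ i → does (P? (f i)))
length-filter-tabulate P? {zero}  f = refl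
length-filter-tabulate P? {suc n} f with does (P? (f zero))
... | true  = cong suc (length-filter-tabulate P? (f ∘ suc))
... | false = length-filter-tabulate P? (f ∘ suc)

count≤2^ : ∀ {m n} (p : Fin m → Bool) (A : Fin n → Bool) (σ : Fin m → Fin n → Bool) →
  (∀ u v → p u ≡ true → p v ≡ true → (∀ a → A a ≡ true → σ u a ≡ σ v a) → u ≡ v) →
  count p ≤ 2 ^ count A
count≤2^ {n = zero} p A σ separated = count≤1 p (λ u v pu pv → separated u v pu pv (λ ()))
count≤2^ {n = suc n} p A σ separated with A zero in A₀
... | false = count≤2^ p (A ∘ suc) (λ v → σ v ∘ suc) (λ u v pu pv agree → separated u v pu pv (agree-suc agree))
  where
  agree-suc : ∀ {u v} → (∀ a → A (suc a) ≡ true → σ u (suc a) ≡ σ v (suc a)) → ∀ a → A a ≡ true → σ u a ≡ σ v a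
  agree-suc agree zero    A₀≡true = contradiction (trans (sym A₀) A₀≡true) λ ()
  agree-suc agree (suc a) = agree a
... | true = begin
  count p
    ≡⟨ count-split p (λ v → σ v zero) ⟩
  count (λ v → p v ∧ σ v zero) + count (λ v → p v ∧ not (σ v zero))
    ≤⟨ +-mono-≤ (half (λ b → b) id-injectiveOnTrue) (half not not-injectiveOnTrue) ⟩
  2 ^ count (A ∘ suc) + 2 ^ count (A ∘ suc)
    ≡⟨ cong (2 ^ count (A ∘ suc) +_) (+-identityʳ _) ⟨
  2 ^ count (A ∘ suc) + (2 ^ count (A ∘ suc) + 0) ∎
  where
  open ≤-Reasoning
  id-injectiveOnTrue : ∀ b c → b ≡ true → c ≡ true → b ≡ c
  id-injectiveOnTrue _ _ refl refl = refl
  not-injectiveOnTrue : ∀ b c → not b ≡ true → not c ≡ true → b ≡ c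
  not-injectiveOnTrue false false _ _ = refl
  half : (f : Bool → Bool) → (∀ b c → f b ≡ true → f c ≡ true → b ≡ c) →
         count (λ v → p v ∧ f (σ v zero)) ≤ 2 ^ count (A ∘ suc)
  half f f-injective = count≤2^ (λ v → p v ∧ f (σ v zero)) (A ∘ suc) (λ v → σ v ∘ suc) sep
    where
    sep : ∀ u v → (p u ∧ f (σ u zero)) ≡ true → (p v ∧ f (σ v zero)) ≡ true →
          (∀ a → A (suc a) ≡ true → σ u (suc a) ≡ σ v (suc a)) → u ≡ v
    sep u v pu pv agree = separated u v (∧≡true⇒ˡ pu) (∧≡true⇒ˡ pv) agree′
      where
      agree′ : ∀ a → A a ≡ true → σ u a ≡ σ v a
      agree′ zero    _ = f-injective _ _ (∧≡true⇒ʳ (p u) pu) (∧≡true⇒ʳ (p v) pv)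
      agree′ (suc a) = agree a


weighted-sum-< : ∀ {n} (h : Fin n → Bool) (s : Fin n → ℕ) {K : ℕ} (z : Fin n) → 1 ≤ K →
  (∀ w → w ≢ z → s w ≤ K) → s z < K + K →
  sum (λ w → indicator (h w) * s w) < K * count h + K
weighted-sum-< {suc n} h s {K} z 1≤K s≤K sz<2K = begin-strict
  sum (λ w → indicator (h w) * s w)
    ≡⟨ sum-remove (λ w → indicator (h w) * s w) ⟩
  indicator (h z) * s z + sum (λ w → indicator (h (punchIn z w)) * s (punchIn z w))
    ≤⟨ +-monoʳ-≤ (indicator (h z) * s z) (sum-mono-≤ (λ w → term≤ (h (punchIn z w)) (s≤K _ (punchInᵢ≢i z w)))) ⟩
  indicator (h z) * s z + sum (λ w → K * indicator (h (punchIn z w)))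
    ≡⟨ cong (indicator (h z) * s z +_) (*-distribˡ-sum K (indicator ∘ h ∘ punchIn z)) ⟨
  indicator (h z) * s z + K * count (h ∘ punchIn z)
    <⟨ head< (h z) ⟩
  K * (indicator (h z) + count (h ∘ punchIn z)) + K
    ≡⟨ cong (λ c → K * c + K) (sum-remove (indicator ∘ h)) ⟨
  K * count h + K ∎
  where
  open ≤-Reasoning
  term≤ : ∀ b {t} → t ≤ K → indicator b * t ≤ K * indicator b
  term≤ true  {t} t≤K = ≤-trans (≤-reflexive (+-identityʳ t)) (≤-trans t≤K (≤-reflexive (sym (*-identityʳ K))))
  term≤ false t≤K = z≤n
  head< : ∀ b → indicator b * s z + K * count (h ∘ punchIn z) < K * (indicator b + count (h ∘ punchIn z)) + K
  head< true  = begin-strict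
    s z + 0 + K * count (h ∘ punchIn z)  ≡⟨ cong (_+ K * count (h ∘ punchIn z)) (+-identityʳ (s z)) ⟩
    s z + K * count (h ∘ punchIn z)      <⟨ +-monoˡ-≤ (K * count (h ∘ punchIn z)) sz<2K ⟩
    K + K + K * count (h ∘ punchIn z)    ≡⟨ rearrange K (count (h ∘ punchIn z)) ⟩
    K * suc (count (h ∘ punchIn z)) + K  ∎
    where
    rearrange : ∀ K c → K + K + K * c ≡ K * (1 + c) + K
    rearrange = solve-∀
  head< false = ≤-trans (≤-reflexive (+-comm 1 (K * count (h ∘ punchIn z)))) (+-monoʳ-≤ _ 1≤K)

2+r≤⇒r≤ : ∀ K d r → 2 + r ≤ K * suc d + K → r ≤ K * d + (K * 2 ∸ 2)
2+r≤⇒r≤ zero    d r ()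
2+r≤⇒r≤ (suc K) d r bound = +-cancelˡ-≤ 2 r _ (≤-trans bound (≤-reflexive (rearrange K d)))
  where
  rearrange : ∀ K d → (1 + K) * (1 + d) + (1 + K) ≡ 2 + ((1 + K) * d + K * 2)
  rearrange = solve-∀

-- Adjacencies and contractions

infix 4 _⊑_

data _⊑_ : Adj → Adj → Set where
  ⊑-refl : ∀ {a} → a ⊑ a
  ⊑-red  : ∀ {a} → a ⊑ red

⊑-trans : ∀ {a b c} → a ⊑ b → b ⊑ c → a ⊑ c
⊑-trans a⊑b ⊑-refl = a⊑b
⊑-trans a⊑b ⊑-red  = ⊑-red

⊑-reflexive : ∀ {a b} → a ≡ b → a ⊑ b
⊑-reflexive refl = ⊑-refl

red-⊑ : ∀ {c} → red ⊑ c → c ≡ red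
red-⊑ ⊑-refl = refl
red-⊑ ⊑-red  = refl

merge-upperˡ : ∀ a b → a ⊑ merge a b
merge-upperˡ none  none  = ⊑-refl
merge-upperˡ black black = ⊑-refl
merge-upperˡ none  black = ⊑-red
merge-upperˡ none  red   = ⊑-red
merge-upperˡ black none  = ⊑-red
merge-upperˡ black red   = ⊑-red
merge-upperˡ red   b     = ⊑-red

merge-upperʳ : ∀ a b → b ⊑ merge a b
merge-upperʳ none  none  = ⊑-refl
merge-upperʳ black black = ⊑-refl
merge-upperʳ none  black = ⊑-red
merge-upperʳ none  red   = ⊑-red
merge-upperʳ black none  = ⊑-red
merge-upperʳ black red   = ⊑-red
merge-upperʳ red   b     = ⊑-red

merge-least : ∀ {a b c} → a ⊑ c → b ⊑ c → merge a b ⊑ c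
merge-least {none}  ⊑-refl ⊑-refl = ⊑-refl
merge-least {black} ⊑-refl ⊑-refl = ⊑-refl
merge-least {red}   ⊑-refl b⊑red  = ⊑-refl
merge-least         ⊑-red  _      = ⊑-red

merge-idem : ∀ a → merge a a ≡ a
merge-idem none  = refl
merge-idem black = refl
merge-idem red   = refl

isRed : Adj → Bool
isRed a = does (isRed? a)

isRed-sound : ∀ {a} → isRed a ≡ true → a ≡ red
isRed-sound {red} _ = refl

isRed-complete : ∀ {a} → a ≡ red → isRed a ≡ true
isRed-complete refl = refl

isBlack : Adj → Bool
isBlack black = true
isBlack _     = false

isBlack-injective : ∀ {a b} → a ≢ red → b ≢ red → isBlack a ≡ isBlack b → a ≡ b
isBlack-injective {none}  {none}  _ _ _ = refl
isBlack-injective {black} {black} _ _ _ = refl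
isBlack-injective {red}   a≢red _ _ = contradiction refl a≢red
isBlack-injective {_}     {red} _ b≢red _ = contradiction refl b≢red
isBlack-injective {none}  {black} _ _ ()
isBlack-injective {black} {none}  _ _ ()

_≟ₐ_ : (a b : Adj) → Dec (a ≡ b)
none  ≟ₐ none  = yes refl
black ≟ₐ black = yes refl
red   ≟ₐ red   = yes refl
none  ≟ₐ black = no λ ()
none  ≟ₐ red   = no λ ()
black ≟ₐ none  = no λ ()
black ≟ₐ red   = no λ ()
red   ≟ₐ none  = no λ ()
red   ≟ₐ black = no λ ()

redDeg≡count : ∀ {n} (E : Mat n) u → redDeg E u ≡ count (λ v → isRed (E u v))
redDeg≡count E u = length-filter-tabulate (λ v → isRed? (E u v)) (λ v → v)

redDeg≡0⇒noRed : ∀ {n} (E : Mat n) {u} → redDeg E u ≡ 0 → ∀ v → E u v ≢ red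
redDeg≡0⇒noRed E {u} deg≡0 v uv-red = contradiction
  (trans (sym (isRed-complete uv-red)) (count≡0⇒false (isRed ∘ E u) (trans (sym (redDeg≡count E u)) deg≡0) v))
  λ ()

card≡count : ∀ {n} (A : VSet n) → card A ≡ count A
card≡count A = trans (length-filter-tabulate (λ v → A v ≟ᵇ true) (λ v → v)) (sum-cong-≗ (cong indicator ∘ does-≟true ∘ A))
  where
  does-≟true : ∀ b → does (b ≟ᵇ true) ≡ b
  does-≟true true  = refl
  does-≟true false = refl

module _ {n : ℕ} (E : Mat (suc n)) (x y : Fin (suc n)) where

  contract-merged-row : ∀ {u v} → punchIn y u ≡ x → punchIn y v ≢ x →
    contract E x y u v ≡ merge (E x (punchIn y v)) (E y (punchIn y v))
  contract-merged-row {u} {v} u↦x v↦̸x with punchIn y u ≟ x | punchIn y v ≟ x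
  ... | yes _ | no _   = refl
  ... | no ¬p | _      = contradiction u↦x ¬p
  ... | yes _ | yes q  = contradiction q v↦̸x

  contract-merged-col : ∀ {u v} → punchIn y u ≢ x → punchIn y v ≡ x →
    contract E x y u v ≡ merge (E (punchIn y u) x) (E (punchIn y u) y)
  contract-merged-col {u} {v} u↦̸x v↦x with punchIn y u ≟ x | punchIn y v ≟ x
  ... | no _  | yes _ = refl
  ... | yes p | _     = contradiction p u↦̸x
  ... | no _  | no ¬q = contradiction v↦x ¬q

  contract-kept : ∀ {u v} → punchIn y u ≢ x → punchIn y v ≢ x →
    contract E x y u v ≡ E (punchIn y u) (punchIn y v)
  contract-kept {u} {v} u↦̸x v↦̸x with punchIn y u ≟ x | punchIn y v ≟ x
  ... | no _  | no _  = refl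
  ... | yes p | _     = contradiction p u↦̸x
  ... | no _  | yes q = contradiction q v↦̸x

  contract-isTrigraph : IsTrigraph E → IsTrigraph (contract E x y)
  contract-isTrigraph G = record { sym = symmetric ; irrefl = irreflexive }
    where
    open IsTrigraph G renaming (sym to E-sym; irrefl to E-irrefl)
    symmetric : ∀ u v → contract E x y u v ≡ contract E x y v u
    symmetric u v with punchIn y u ≟ x | punchIn y v ≟ x
    ... | yes _ | yes _ = refl
    ... | yes _ | no _  = cong₂ merge (E-sym _ _) (E-sym _ _)
    ... | no _  | yes _ = cong₂ merge (E-sym _ _) (E-sym _ _)
    ... | no _  | no _  = E-sym _ _
    irreflexive : ∀ u → contract E x y u u ≡ none
    irreflexive u with punchIn y u ≟ x
    ... | yes _ = refl
    ... | no _  = E-irrefl _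

module Collapse {n : ℕ} (x y : Fin (suc n)) (x≢y : x ≢ y) where

  -- The vertex of G/xy that contains a given vertex of G.
  collapse : Fin (suc n) → Fin n
  collapse w with w ≟ y
  ... | yes _   = punchOut (x≢y ∘ sym)
  ... | no w≢y = punchOut (w≢y ∘ sym)

  punchIn-collapse-y : punchIn y (collapse y) ≡ x
  punchIn-collapse-y with y ≟ y
  ... | yes _   = punchIn-punchOut _
  ... | no y≢y = contradiction refl y≢y

  punchIn-collapse : ∀ {w} → w ≢ y → punchIn y (collapse w) ≡ w
  punchIn-collapse {w} w≢y with w ≟ y
  ... | yes w≡y = contradiction w≡y w≢y
  ... | no _    = punchIn-punchOut _

  collapse-y : collapse y ≡ collapse x
  collapse-y = punchIn-injective y _ _ (trans punchIn-collapse-y (sym (punchIn-collapse x≢y)))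

  collapse-punchIn : ∀ u → collapse (punchIn y u) ≡ u
  collapse-punchIn u = punchIn-injective y _ _ (punchIn-collapse (punchInᵢ≢i y u))

  collapse⁻¹-x : ∀ {w} → collapse w ≡ collapse x → w ≡ x ⊎ w ≡ y
  collapse⁻¹-x {w} w↦z = by-cases (w ≟ y)
    where
    by-cases : Dec (w ≡ y) → w ≡ x ⊎ w ≡ y
    by-cases (yes w≡y) = inj₂ w≡y
    by-cases (no w≢y)  = inj₁ (begin
      w                       ≡⟨ punchIn-collapse w≢y ⟨
      punchIn y (collapse w)  ≡⟨ cong (punchIn y) w↦z ⟩
      punchIn y (collapse x)  ≡⟨ punchIn-collapse x≢y ⟩
      x                       ∎)
      where open ≡-Reasoning

  collapse-injective-off-x : ∀ {w₁ w₂} → collapse w₁ ≡ collapse w₂ → collapse w₁ ≢ collapse x → w₁ ≡ w₂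
  collapse-injective-off-x {w₁} {w₂} same off = by-cases (w₁ ≟ y) (w₂ ≟ y)
    where
    by-cases : Dec (w₁ ≡ y) → Dec (w₂ ≡ y) → w₁ ≡ w₂
    by-cases (yes refl) _          = contradiction collapse-y off
    by-cases (no _)     (yes refl) = contradiction (trans same collapse-y) off
    by-cases (no w₁≢y)  (no w₂≢y)  =
      trans (sym (punchIn-collapse w₁≢y)) (trans (cong (punchIn y) same) (punchIn-collapse w₂≢y))

  punchIn-collapse≢x : ∀ {w} → punchIn y (collapse w) ≢ x → punchIn y (collapse w) ≡ w
  punchIn-collapse≢x {w} ↦̸x = by-cases (w ≟ y)
    where
    by-cases : Dec (w ≡ y) → punchIn y (collapse w) ≡ w
    by-cases (yes refl) = contradiction punchIn-collapse-y ↦̸x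
    by-cases (no w≢y)   = punchIn-collapse w≢y

  punchIn-collapse≡x : ∀ {w} → punchIn y (collapse w) ≡ x → w ≡ x ⊎ w ≡ y
  punchIn-collapse≡x ↦x = collapse⁻¹-x (punchIn-injective y _ _ (trans ↦x (sym (punchIn-collapse x≢y))))

  ⊑-merge-of : ∀ (f : Fin (suc n) → Adj) {w} → w ≡ x ⊎ w ≡ y → f w ⊑ merge (f x) (f y)
  ⊑-merge-of f (inj₁ refl) = merge-upperˡ _ _
  ⊑-merge-of f (inj₂ refl) = merge-upperʳ _ _

  ⊑-contract : ∀ (E : Mat (suc n)) {w₁ w₂} → collapse w₁ ≢ collapse w₂ →
    E w₁ w₂ ⊑ contract E x y (collapse w₁) (collapse w₂)
  ⊑-contract E {w₁} {w₂} apart = by-cases (punchIn y (collapse w₁) ≟ x) (punchIn y (collapse w₂) ≟ x)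
    where
    u = collapse w₁
    v = collapse w₂
    by-cases : Dec (punchIn y u ≡ x) → Dec (punchIn y v ≡ x) → E w₁ w₂ ⊑ contract E x y u v
    by-cases (yes p) (yes q) = contradiction (punchIn-injective y _ _ (trans p (sym q))) apart
    by-cases (yes p) (no ¬q) = subst (E w₁ w₂ ⊑_) (sym (contract-merged-row E x y p ¬q))
      (merged-row (punchIn-collapse≢x ¬q) (punchIn-collapse≡x p))
      where
      merged-row : ∀ {t} → t ≡ w₂ → w₁ ≡ x ⊎ w₁ ≡ y → E w₁ w₂ ⊑ merge (E x t) (E y t)
      merged-row refl = ⊑-merge-of (λ w → E w w₂)
    by-cases (no ¬p) (yes q) = subst (E w₁ w₂ ⊑_) (sym (contract-merged-col E x y ¬p q))
      (merged-col (punchIn-collapse≢x ¬p) (punchIn-collapse≡x q))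
      where
      merged-col : ∀ {t} → t ≡ w₁ → w₂ ≡ x ⊎ w₂ ≡ y → E w₁ w₂ ⊑ merge (E t x) (E t y)
      merged-col refl = ⊑-merge-of (E w₁)
    by-cases (no ¬p) (no ¬q) = subst (E w₁ w₂ ⊑_) (sym (contract-kept E x y ¬p ¬q))
      (⊑-reflexive (cong₂ E (sym (punchIn-collapse≢x ¬p)) (sym (punchIn-collapse≢x ¬q))))

  collapse-x : ∀ {u} → punchIn y u ≡ x → collapse x ≡ u
  collapse-x {u} u↦x = trans (cong collapse (sym u↦x)) (collapse-punchIn u)

  contract-⊑ : ∀ (E : Mat (suc n)) (B : Mat n) (Apart : Fin n → Fin n → Set) → (∀ {u} → ¬ Apart u u) →
    (∀ {w₁ w₂} → Apart (collapse w₁) (collapse w₂) → E w₁ w₂ ⊑ B (collapse w₁) (collapse w₂)) →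
    ∀ {u v} → Apart u v → contract E x y u v ⊑ B u v
  contract-⊑ E B Apart irreflexive E⊑B {u} {v} apart = by-cases (punchIn y u ≟ x) (punchIn y v ≟ x)
    where
    E⊑B-at : ∀ {w₁ w₂} → collapse w₁ ≡ u → collapse w₂ ≡ v → E w₁ w₂ ⊑ B u v
    E⊑B-at refl refl = E⊑B apart
    by-cases : Dec (punchIn y u ≡ x) → Dec (punchIn y v ≡ x) → contract E x y u v ⊑ B u v
    by-cases (yes p) (yes q) =
      contradiction (subst (Apart u) (sym (punchIn-injective y _ _ (trans p (sym q)))) apart) irreflexive
    by-cases (yes p) (no ¬q) = subst (_⊑ B u v) (sym (contract-merged-row E x y p ¬q))
      (merge-least (E⊑B-at (collapse-x p) (collapse-punchIn v))
                   (E⊑B-at (trans collapse-y (collapse-x p)) (collapse-punchIn v)))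
    by-cases (no ¬p) (yes q) = subst (_⊑ B u v) (sym (contract-merged-col E x y ¬p q))
      (merge-least (E⊑B-at (collapse-punchIn u) (collapse-x q))
                   (E⊑B-at (collapse-punchIn u) (trans collapse-y (collapse-x q))))
    by-cases (no ¬p) (no ¬q) = subst (_⊑ B u v) (sym (contract-kept E x y ¬p ¬q))
      (E⊑B-at (collapse-punchIn u) (collapse-punchIn v))

SameOn : ∀ {n} → VSet n → Mat n → Fin n → Fin n → Set
SameOn A E u v = ∀ a → A a ≡ true → E u a ≡ E v a

NoRedAt : ∀ {n} → VSet n → Mat n → Set
NoRedAt A E = ∀ a → A a ≡ true → ∀ v → E a v ≢ red

module _ {n : ℕ} (E : Mat (suc n)) (A : VSet (suc n)) {x y : Fin (suc n)}
         (x∉A : A x ≡ false) (twins : SameOn A E x y) where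

  ∈A⇒≢x : ∀ {w} → A w ≡ true → w ≢ x
  ∈A⇒≢x w∈A refl = contradiction (trans (sym w∈A) x∉A) λ ()

  contract-twins-at : ∀ v {a} → A (punchIn y a) ≡ true →
    contract E x y v a ≡ E (punchIn y v) (punchIn y a)
  contract-twins-at v {a} a∈A = by-cases (punchIn y v ≟ x)
    where
    open ≡-Reasoning
    by-cases : Dec (punchIn y v ≡ x) → contract E x y v a ≡ E (punchIn y v) (punchIn y a)
    by-cases (no v↦̸x) = contract-kept E x y v↦̸x (∈A⇒≢x a∈A)
    by-cases (yes v↦x) = begin
      contract E x y v a                             ≡⟨ contract-merged-row E x y v↦x (∈A⇒≢x a∈A) ⟩
      merge (E x (punchIn y a)) (E y (punchIn y a))  ≡⟨ cong (merge _) (twins _ a∈A) ⟨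
      merge (E x (punchIn y a)) (E x (punchIn y a))  ≡⟨ merge-idem _ ⟩
      E x (punchIn y a)                              ≡⟨ cong (λ w → E w (punchIn y a)) v↦x ⟨
      E (punchIn y v) (punchIn y a)                  ∎

  contract-twins-noRedAt : IsTrigraph E → NoRedAt A E → NoRedAt (contractSet A y) (contract E x y)
  contract-twins-noRedAt G noRed a a∈A v uv-red = noRed (punchIn y a) a∈A (punchIn y v) (begin
    E (punchIn y a) (punchIn y v)  ≡⟨ IsTrigraph.sym G _ _ ⟩
    E (punchIn y v) (punchIn y a)  ≡⟨ contract-twins-at v a∈A ⟨
    contract E x y v a             ≡⟨ IsTrigraph.sym (contract-isTrigraph E x y G) v a ⟩
    contract E x y a v             ≡⟨ uv-red ⟩
    red                            ∎)
    where open ≡-Reasoning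

-- Refinements of a contraction sequence

record Refinement (k : ℕ) {nc : ℕ} (H : Mat nc) {m : ℕ} (F : Mat m) (A : VSet m) : Set where
  field
    isTrigraph : IsTrigraph F
    noRedAt    : NoRedAt A F
    count-A    : count A ≡ k
    π          : Fin m → Fin nc
    ⊑-π        : ∀ {u v} → π u ≢ π v → F u v ⊑ H (π u) (π v)

closedRedNbhd : ∀ {n} → Mat n → Fin n → Fin n → Bool
closedRedNbhd H c w = (w == c) ∨ isRed (H c w)

count-closedRedNbhd : ∀ {n} (H : Mat n) c → count (closedRedNbhd H c) ≤ suc (redDeg H c)
count-closedRedNbhd H c = begin
  count (closedRedNbhd H c)                       ≤⟨ count-∨ (_== c) (isRed ∘ H c) ⟩
  count (_== c) + count (isRed ∘ H c)              ≡⟨ cong₂ _+_ (count-== c) (sym (redDeg≡count H c)) ⟩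
  suc (redDeg H c)                                ∎
  where open ≤-Reasoning

module _ {k nc : ℕ} {H : Mat nc} {m : ℕ} {F : Mat m} {A : VSet m} (R : Refinement k H F A) where
  open Refinement R

  partSize : Fin nc → ℕ
  partSize w = count (λ v → (π v == w) ∧ not (A v))

  Reduced : Fin nc → Set
  Reduced w = ∀ {u v} → π u ≡ w → π v ≡ w → A u ≡ false → A v ≡ false → SameOn A F u v → u ≡ v

  ∈part : ∀ {v w} → π v ≡ w → A v ≡ false → ((π v == w) ∧ not (A v)) ≡ true
  ∈part {v} refl v∉A = cong₂ (λ a b → a ∧ not b) (==-refl (π v)) v∉A

  ∈part⁻¹ : ∀ {v w} → ((π v == w) ∧ not (A v)) ≡ true → π v ≡ w × A v ≡ false
  ∈part⁻¹ v∈w = ==-sound (∧≡true⇒ˡ v∈w) , not-injective (∧≡true⇒ʳ _ v∈w)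

  noRedInto : ∀ {a} v → A a ≡ true → F v a ≢ red
  noRedInto v a∈A va-red = noRedAt _ a∈A v (trans (IsTrigraph.sym isTrigraph _ v) va-red)

  ∉A-of-red : ∀ {u v} → F u v ≡ red → A v ≡ false
  ∉A-of-red {u} uv-red = ¬-not λ v∈A → noRedInto u v∈A uv-red

  redFree : RedFree F A
  redFree a a∈A = trans (redDeg≡count F a) (count-false (λ v → ¬-not (noRedAt a a∈A v ∘ isRed-sound)))

  partSize-reduced : ∀ {w} → Reduced w → partSize w ≤ 2 ^ k
  partSize-reduced {w} reduced = subst (λ c → partSize w ≤ 2 ^ c) count-A
    (count≤2^ (λ v → (π v == w) ∧ not (A v)) A (λ v a → isBlack (F v a)) separated)
    where
    separated : ∀ u v → ((π u == w) ∧ not (A u)) ≡ true → ((π v == w) ∧ not (A v)) ≡ true →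
                (∀ a → A a ≡ true → isBlack (F u a) ≡ isBlack (F v a)) → u ≡ v
    separated u v u∈w v∈w same-type with ∈part⁻¹ u∈w | ∈part⁻¹ v∈w
    ... | u↦w , u∉A | v↦w , v∉A = reduced u↦w v↦w u∉A v∉A
      (λ a a∈A → isBlack-injective (noRedInto u a∈A) (noRedInto v a∈A) (same-type a a∈A))

  closedRedNbhd-of-red : ∀ {u v} → F u v ≡ red → closedRedNbhd H (π u) (π v) ≡ true
  closedRedNbhd-of-red {u} {v} uv-red with π v ≟ π u
  ... | yes _     = refl
  ... | no πv≢πu = isRed-complete (red-⊑ (subst (_⊑ _) uv-red (⊑-π (πv≢πu ∘ sym))))

  suc-redDeg≤ : ∀ {u} → A u ≡ false →
    suc (redDeg F u) ≤ sum (λ w → indicator (closedRedNbhd H (π u) w) * partSize w)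
  suc-redDeg≤ {u} u∉A = begin
    suc (redDeg F u)
      ≡⟨ cong suc (redDeg≡count F u) ⟩
    suc (count (isRed ∘ F u))
      ≡⟨ count-insert (isRed ∘ F u) u (cong isRed (IsTrigraph.irrefl isTrigraph u)) ⟨
    count (λ v → (v == u) ∨ isRed (F u v))
      ≤⟨ count-mono self-or-red ⟩
    count (λ v → closedRedNbhd H (π u) (π v) ∧ not (A v))
      ≡⟨ count-fibres π (closedRedNbhd H (π u)) (not ∘ A) ⟩
    sum (λ w → indicator (closedRedNbhd H (π u) w) * partSize w) ∎
    where
    open ≤-Reasoning
    self-or-red : ∀ v → (v == u) ∨ isRed (F u v) ≡ true → closedRedNbhd H (π u) (π v) ∧ not (A v) ≡ true
    self-or-red v with v ≟ u
    ... | yes refl = λ _ → cong₂ (λ a b → (a ∨ _) ∧ not b) (==-refl (π u)) u∉A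
    ... | no _     = λ uv-red → cong₂ (λ a b → a ∧ not b)
                       (closedRedNbhd-of-red (isRed-sound uv-red)) (∉A-of-red (isRed-sound uv-red))

  width≤ : ∀ {d} → MaxRedDeg≤ H d → (z : Fin nc) → (∀ w → w ≢ z → partSize w ≤ 2 ^ k) →
    partSize z < 2 ^ k + 2 ^ k → MaxRedDeg≤ F (2 ^ k * d + (2 ^ (k + 1) ∸ 2))
  width≤ {d} H≤d z small-parts z-part u with A u in Au
  ... | true  = subst (_≤ _) (sym (redFree u Au)) z≤n
  ... | false = subst (λ t → redDeg F u ≤ 2 ^ k * d + (t ∸ 2)) (sym (^-distribˡ-+-* 2 k 1))
    (2+r≤⇒r≤ (2 ^ k) d (redDeg F u) (begin
      2 + redDeg F u
        ≤⟨ s≤s (suc-redDeg≤ Au) ⟩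
      suc (sum (λ w → indicator (closedRedNbhd H (π u) w) * partSize w))
        ≤⟨ weighted-sum-< (closedRedNbhd H (π u)) partSize z (m^n>0 2 k) small-parts z-part ⟩
      2 ^ k * count (closedRedNbhd H (π u)) + 2 ^ k
        ≤⟨ +-monoˡ-≤ (2 ^ k) (*-monoʳ-≤ (2 ^ k) (≤-trans (count-closedRedNbhd H (π u)) (s≤s (H≤d (π u))))) ⟩
      2 ^ k * suc d + 2 ^ k ∎))
    where open ≤-Reasoning


module _ {k nc : ℕ} {H : Mat (suc nc)} {m : ℕ} {F : Mat m} {A : VSet m} (R : Refinement k H F A)
         {x y : Fin (suc nc)} (x≢y : x ≢ y) where
  open Refinement R
  open Collapse x y x≢y

  coarsen : Refinement k (contract H x y) F A
  coarsen = record
    { isTrigraph = isTrigraph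
    ; noRedAt    = noRedAt
    ; count-A    = count-A
    ; π          = collapse ∘ π
    ; ⊑-π        = λ apart → ⊑-trans (⊑-π (apart ∘ cong collapse)) (⊑-contract H apart)
    }

  reduced-coarsen : (∀ w → Reduced R w) → ∀ {w} → w ≢ collapse x → Reduced coarsen w
  reduced-coarsen reduced w≢z πu↦w πv↦w =
    reduced _ refl (sym (collapse-injective-off-x (trans πu↦w (sym πv↦w)) (w≢z ∘ trans (sym πu↦w))))

  partSize-coarsen : partSize coarsen (collapse x) ≤ partSize R x + partSize R y
  partSize-coarsen = ≤-trans (count-mono from-x-or-y)
    (count-∨ (λ v → (π v == x) ∧ not (A v)) (λ v → (π v == y) ∧ not (A v)))
    where
    from-x-or-y : ∀ v → ((collapse (π v) == collapse x) ∧ not (A v)) ≡ true →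
      ((π v == x) ∧ not (A v)) ∨ ((π v == y) ∧ not (A v)) ≡ true
    from-x-or-y v v∈z with ∈part⁻¹ coarsen v∈z
    ... | v↦z , v∉A with collapse⁻¹-x v↦z
    ...   | inj₁ πv≡x = cong (_∨ _) (∈part R πv≡x v∉A)
    ...   | inj₂ πv≡y = trans (cong (_ ∨_) (∈part R πv≡y v∉A)) (∨-zeroʳ _)

record Twins {k nc : ℕ} {H : Mat nc} {m : ℕ} {F : Mat m} {A : VSet m} (R : Refinement k H F A)
             (w : Fin nc) (u₁ u₂ : Fin m) : Set where
  field
    distinct : u₁ ≢ u₂
    u₁∈w     : Refinement.π R u₁ ≡ w
    u₂∈w     : Refinement.π R u₂ ≡ w
    u₁∉A     : A u₁ ≡ false
    u₂∉A     : A u₂ ≡ false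
    same     : SameOn A F u₁ u₂

module _ {k nc : ℕ} {H : Mat nc} {m : ℕ} {F : Mat (suc m)} {A : VSet (suc m)} (R : Refinement k H F A)
         {w : Fin nc} {u₁ u₂ : Fin (suc m)} (T : Twins R w u₁ u₂) where
  open Refinement R
  open Twins T
  open Collapse u₁ u₂ distinct

  π-collapse : ∀ v → π (punchIn u₂ (collapse v)) ≡ π v
  π-collapse v = by-cases (v ≟ u₂)
    where
    by-cases : Dec (v ≡ u₂) → π (punchIn u₂ (collapse v)) ≡ π v
    by-cases (yes refl) = trans (cong π punchIn-collapse-y) (trans u₁∈w (sym u₂∈w))
    by-cases (no v≢u₂)  = cong π (punchIn-collapse v≢u₂)

  contractTwins : Refinement k H (contract F u₁ u₂) (contractSet A u₂)
  contractTwins = record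
    { isTrigraph = contract-isTrigraph F u₁ u₂ isTrigraph
    ; noRedAt    = contract-twins-noRedAt F A u₁∉A same isTrigraph noRedAt
    ; count-A    = trans (count-punchIn-false A u₂∉A) count-A
    ; π          = π ∘ punchIn u₂
    ; ⊑-π        = contract-⊑ F (λ i j → H (π (punchIn u₂ i)) (π (punchIn u₂ j)))
                     (λ i j → π (punchIn u₂ i) ≢ π (punchIn u₂ j)) (λ apart → apart refl) ⊑-H
    }
    where
    ⊑-H : ∀ {v₁ v₂} → π (punchIn u₂ (collapse v₁)) ≢ π (punchIn u₂ (collapse v₂)) →
          F v₁ v₂ ⊑ H (π (punchIn u₂ (collapse v₁))) (π (punchIn u₂ (collapse v₂)))
    ⊑-H {v₁} {v₂} apart rewrite π-collapse v₁ | π-collapse v₂ = ⊑-π apart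

  reduced-contractTwins : ∀ {w′} → Reduced R w′ → Reduced contractTwins w′
  reduced-contractTwins reduced v₁↦w v₂↦w v₁∉A v₂∉A same′ = punchIn-injective u₂ _ _
    (reduced v₁↦w v₂↦w v₁∉A v₂∉A (sameOn-punchIn same′))
    where
    sameOn-punchIn : ∀ {v₁ v₂} → SameOn (contractSet A u₂) (contract F u₁ u₂) v₁ v₂ →
                     SameOn A F (punchIn u₂ v₁) (punchIn u₂ v₂)
    sameOn-punchIn {v₁} {v₂} same′ a a∈A = begin
      F (punchIn u₂ v₁) a                 ≡⟨ cong (F _) (punchIn-punchOut u₂≢a) ⟨
      F (punchIn u₂ v₁) (punchIn u₂ a′)   ≡⟨ contract-twins-at F A u₁∉A same v₁ a′∈A ⟨
      contract F u₁ u₂ v₁ a′              ≡⟨ same′ a′ a′∈A ⟩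
      contract F u₁ u₂ v₂ a′              ≡⟨ contract-twins-at F A u₁∉A same v₂ a′∈A ⟩
      F (punchIn u₂ v₂) (punchIn u₂ a′)   ≡⟨ cong (F _) (punchIn-punchOut u₂≢a) ⟩
      F (punchIn u₂ v₂) a                 ∎
      where
      open ≡-Reasoning
      u₂≢a : u₂ ≢ a
      u₂≢a refl = contradiction (trans (sym a∈A) u₂∉A) λ ()
      a′ = punchOut u₂≢a
      a′∈A : A (punchIn u₂ a′) ≡ true
      a′∈A = trans (cong A (punchIn-punchOut u₂≢a)) a∈A

  partSize-contractTwins : partSize R w ≡ suc (partSize contractTwins w)
  partSize-contractTwins = trans (count-punchIn (λ v → (π v == w) ∧ not (A v)) u₂)
    (cong (λ b → indicator b + partSize contractTwins w) (∈part R u₂∈w u₂∉A))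

module _ {k nc : ℕ} {H : Mat nc} {m : ℕ} {F : Mat m} {A : VSet m} (R : Refinement k H F A) where
  open Refinement R

  sameOn? : ∀ u v → Dec (SameOn A F u v)
  sameOn? u v = all? (λ a → (A a ≟ᵇ true) →-dec (F u a ≟ₐ F v a))

  twins-or-reduced : ∀ z → (∃₂ λ u₁ u₂ → Twins R z u₁ u₂) ⊎ Reduced R z
  twins-or-reduced z with any? (λ u₁ → any? (λ u₂ → twins? u₁ u₂))
    where
    twins? : ∀ u₁ u₂ → Dec (Twins R z u₁ u₂)
    twins? u₁ u₂ = map′ (λ (d , p₁ , p₂ , a₁ , a₂ , s) → record
                          { distinct = d ; u₁∈w = p₁ ; u₂∈w = p₂ ; u₁∉A = a₁ ; u₂∉A = a₂ ; same = s })
                        (λ T → let open Twins T in distinct , u₁∈w , u₂∈w , u₁∉A , u₂∉A , same)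
                        (¬? (u₁ ≟ u₂) ×-dec π u₁ ≟ z ×-dec π u₂ ≟ z ×-dec
                         A u₁ ≟ᵇ false ×-dec A u₂ ≟ᵇ false ×-dec sameOn? u₁ u₂)
  ... | yes (u₁ , u₂ , T) = inj₁ (u₁ , u₂ , T)
  ... | no ∄twins = inj₂ λ {u₁} {u₂} p₁ p₂ a₁ a₂ s → decidable-stable (u₁ ≟ u₂)
          (λ u₁≢u₂ → ∄twins (u₁ , u₂ , record
             { distinct = u₁≢u₂ ; u₁∈w = p₁ ; u₂∈w = p₂ ; u₁∉A = a₁ ; u₂∉A = a₂ ; same = s }))

headWidth : ∀ {d n} {E : Mat n} {A} {m} {E′ : Mat m} {A′} → PSeq d E A E′ A′ → MaxRedDeg≤ E d
headWidth (done E≤d _)             = E≤d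
headWidth (step E≤d _ _ _ _ _ _ _) = E≤d

_++_ : ∀ {d n} {E : Mat n} {A} {m} {E′ : Mat m} {A′} {l} {E″ : Mat l} {A″} →
       PSeq d E A E′ A′ → PSeq d E′ A′ E″ A″ → PSeq d E A E″ A″
done _ _                ++ rest = rest
step E≤d free x y x≢y x∉A y∉A seq ++ rest = step E≤d free x y x≢y x∉A y∉A (seq ++ rest)

_◅′_ : ∀ {d n} {E : Mat n} {A} {m} {E′ : Mat m} {A′} →
       PSeq d E A E′ A′ → TwwRelAtMost E′ A′ d → TwwRelAtMost E A d
seq ◅′ (_ , _ , _ , rest , complete) = _ , _ , _ , seq ++ rest , complete

module Construction (k d : ℕ) where

  width : ℕ
  width = 2 ^ k * d + (2 ^ (k + 1) ∸ 2)

  width-reduced : ∀ {nc} {H : Mat nc} {m} {F : Mat m} {A} (R : Refinement k H F A) →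
    MaxRedDeg≤ H d → (∀ w → Reduced R w) → MaxRedDeg≤ F width
  width-reduced R H≤d reduced u = width≤ R H≤d (Refinement.π R u) (λ w _ → partSize-reduced R (reduced w))
    (≤-trans (s≤s (partSize-reduced R (reduced _))) (m<m+n (2 ^ k) (m^n>0 2 k))) u

  ReducedRefinement : ∀ {nc} (H : Mat nc) {m} (F : Mat m) (A : VSet m) → Set
  ReducedRefinement H F A = Σ ℕ λ m′ → Σ (Mat m′) λ F′ → Σ (VSet m′) λ A′ →
    Σ (Refinement k H F′ A′) λ R′ → (∀ w → Reduced R′ w) × PSeq width F A F′ A′

  _◅_ : ∀ {nc} {H : Mat nc} {m} {F : Mat m} {A} {m₁} {F₁ : Mat m₁} {A₁} →
    PSeq width F A F₁ A₁ → ReducedRefinement H F₁ A₁ → ReducedRefinement H F A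
  seq ◅ (_ , _ , _ , R , reduced , rest) = _ , _ , _ , R , reduced , seq ++ rest

  reduce : ∀ {nc} {H : Mat nc} → MaxRedDeg≤ H d → (z : Fin nc) →
    ∀ m {F : Mat m} {A} (R : Refinement k H F A) → (∀ w → w ≢ z → Reduced R w) →
    partSize R z ≤ 2 ^ k + 2 ^ k → MaxRedDeg≤ F width → ReducedRefinement H F A
  reduce H≤d z zero    R reduced-off-z _ F≤width = _ , _ , _ , R , (λ _ {u} → contradiction u ¬Fin0) , done F≤width (redFree R)
  reduce H≤d z (suc m) R reduced-off-z z-small F≤width with twins-or-reduced R z
  ... | inj₂ z-reduced = _ , _ , _ , R , reduced , done F≤width (redFree R)
    where
    reduced : ∀ w → Reduced R w
    reduced w with w ≟ z
    ... | yes refl = z-reduced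
    ... | no w≢z   = reduced-off-z w w≢z
  ... | inj₁ (u₁ , u₂ , T) =
    step F≤width (redFree R) u₁ u₂ distinct u₁∉A u₂∉A (done F′≤width (redFree R′))
      ◅ reduce H≤d z m R′ reduced′ (≤-trans (n≤1+n _) z-small′) F′≤width
    where
    open Twins T
    R′ = contractTwins R T
    reduced′ : ∀ w → w ≢ z → Reduced R′ w
    reduced′ w w≢z = reduced-contractTwins R T (reduced-off-z w w≢z)
    z-small′ : suc (partSize R′ z) ≤ 2 ^ k + 2 ^ k
    z-small′ = subst (_≤ 2 ^ k + 2 ^ k) (partSize-contractTwins R T) z-small
    F′≤width : MaxRedDeg≤ (contract _ u₁ u₂) width
    F′≤width = width≤ R′ H≤d z (λ w w≢z → partSize-reduced R′ (reduced′ w w≢z)) z-small′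

  refine : ∀ {nc} {H : Mat nc} {B} {H₁ : Mat 1} {B₁} → PSeq d H B H₁ B₁ →
    ∀ {m} {F : Mat m} {A} (R : Refinement k H F A) → (∀ w → Reduced R w) → TwwRelAtMost F A width
  refine (done H≤d _) {F = F} {A} R reduced =
    _ , _ , _ , done (width-reduced R H≤d reduced) (redFree R) , complete
    where
    open Refinement R
    one-part : ∀ (i j : Fin 1) → i ≡ j
    one-part zero zero = refl
    complete : Complete F A
    complete u v u≢v u∉A v∉A same = u≢v (reduced (π u) refl (one-part (π v) (π u)) u∉A v∉A same)
  refine (step H≤d _ x y x≢y _ _ rest) R reduced = continue (reduce (headWidth rest) (collapse x) _
      (coarsen R x≢y) (λ _ → reduced-coarsen R x≢y reduced) z-small (width-reduced R H≤d reduced))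
    where
    open Collapse x y x≢y
    z-small : partSize (coarsen R x≢y) (collapse x) ≤ 2 ^ k + 2 ^ k
    z-small = ≤-trans (partSize-coarsen R x≢y)
      (+-mono-≤ (partSize-reduced R (reduced x)) (partSize-reduced R (reduced y)))
    continue : ReducedRefinement _ _ _ → TwwRelAtMost _ _ width
    continue (_ , _ , _ , R′ , reduced′ , seq) = seq ◅′ refine rest R′ reduced′

identityRefinement : ∀ {n} {E : Mat n} → IsTrigraph E → (A : VSet n) → RedFree E A → Refinement (card A) E E A
identityRefinement {E = E} G A redFree = record
  { isTrigraph = G
  ; noRedAt    = λ a a∈A → redDeg≡0⇒noRed E (redFree a a∈A)
  ; count-A    = sym (card≡count A)
  ; π          = λ v → v
  ; ⊑-π        = λ _ → ⊑-refl
  }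

corollary14 : (n : ℕ) (E : Mat n) → IsTrigraph E → (A : VSet n) → RedFree E A →
    (d : ℕ) → TwwAtMost E d →
    TwwRelAtMost E A (2 ^ card A * d + (2 ^ (card A + 1) ∸ 2))
corollary14 n E G A redFree d (_ , _ , sequence) =
  refine sequence (identityRefinement G A redFree) (λ _ u↦w v↦w _ _ _ → trans u↦w (sym v↦w))
  where open Construction (card A) d
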